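{- For every formula $\varphi$ of propositional linear temporal logic, $\mathrm{LTL} \models \neg \Box (\varphi\leftrightarrow \bigcirc\Box\diamondsuit \neg\varphi)$.
   Context: Propositional linear temporal logic (LTL) over a set $\mathbf{V}$ of propositional constants, with formulas built from $\mathbf{V}$, $\mathbf{false}$, $\rightarrow$, the "next" operator $\bigcirc$ and the "always" operator $\Box$; $\diamondsuit\varphi$ ("sometime") abbreviates $\neg\Box\neg\varphi$. A temporal (Kripke) structure is an infinite sequence $\mathcal{K}=(\eta_0,\eta_1,\dots)$ of valuations $\eta_i:\mathbf{V}\to\{\mathfrak{ff},\mathfrak{tt}\}$, with $\mathcal{K}_i(v)=\eta_i(v)$, classical clauses for the connectives, $\mathcal{K}_i(\bigcirc\varphi)=\mathcal{K}_{i+1}(\varphi)$, and $\mathcal{K}_i(\Box\varphi)=\mathfrak{tt}$ iff $\mathcal{K}_j(\varphi)=\mathfrak{tt}$ for all $j\ge i$. $\mathrm{LTL}\models\varphi$ means $\mathcal{K}_i(\varphi)=\mathfrak{tt}$ for every temporal structure $\mathcal{K}$ and every $i\in\mathbb{N}$. -}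

module Defs where

open import Data.Nat using (ℕ; suc; _≤_)
open import Data.Bool using (Bool; true; false)
open import Data.Empty using (⊥)
open import Data.Product using (_×_)
open import Relation.Binary.PropositionalEquality using (_≡_)

data Formula (V : Set) : Set where
  var    : V → Formula V
  ff     : Formula V
  _⇒_    : Formula V → Formula V → Formula V
  ○_     : Formula V → Formula V
  □_     : Formula V → Formula V

infixr 5 _⇒_
infix 7 ○_ □_

module _ {V : Set} where
  infix 7 ◇_ ¬ᶠ_
  infix 4 _⇔_
  infixr 6 _∧ᶠ_

  ¬ᶠ_ : Formula V → Formula V
  ¬ᶠ φ = φ ⇒ ff

  ◇_ : Formula V → Formula V
  ◇ φ = ¬ᶠ (□ (¬ᶠ φ))

  _∧ᶠ_ : Formula V → Formula V → Formula V
  φ ∧ᶠ ψ = ¬ᶠ (φ ⇒ ¬ᶠ ψ)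

  _⇔_ : Formula V → Formula V → Formula V
  φ ⇔ ψ = (φ ⇒ ψ) ∧ᶠ (ψ ⇒ φ)

Kripke : Set → Set
Kripke V = ℕ → V → Bool

-- K_i(φ) = tt, as a proposition.
_,_⊨_ : {V : Set} → Kripke V → ℕ → Formula V → Set
K , i ⊨ var v   = K i v ≡ true
K , i ⊨ ff      = ⊥
K , i ⊨ (φ ⇒ ψ) = K , i ⊨ φ → K , i ⊨ ψ
K , i ⊨ (○ φ)   = K , suc i ⊨ φ
K , i ⊨ (□ φ)   = (j : ℕ) → i ≤ j → K , j ⊨ φ

LTL⊨ : {V : Set} → Formula V → Set
LTL⊨ {V} φ = (K : Kripke V) (i : ℕ) → K , i ⊨ φ

module Submission where

-- Write ψ for ○□◇¬φ and suppose □(φ ⇔ ψ) holds at state i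
-- of a temporal structure K.  The semantics is read constructively, so ⇔ yields
-- each of its directions only up to double negation; as the goal is ⊥ this
-- suffices.
--   1. φ fails at every j ≥ i.  If φ held at j, then ψ would, i.e. ◇¬φ holds
--      at every state from j+1 on.  Yet ¬¬φ also holds at every m ≥ j+1:
--      ψ is inherited at m from j (□ is preserved along suffixes), and ψ
--      gives back φ at m.  So □¬¬φ holds at j+1, refuting ◇¬φ there.
--   2. Hence □¬φ holds from i+1 on, so does □◇¬φ, i.e. ψ holds at i; then
--      the biconditional yields φ at i, contradicting step 1.
-- The file first collects small facts about the semantics (directions of ⇔,
-- suffix-closure of □, □χ ⇒ □◇χ), then proves step 1, then the theorem.

open import Defs
open import Data.Nat using (suc; _≤_)
open import Data.Nat.Properties using (≤-refl; ≤-trans; n≤1+n; m≤n⇒m≤1+n)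
open import Relation.Nullary using (¬_)

○□◇¬ : {V : Set} → Formula V → Formula V
○□◇¬ φ = ○ (□ (◇ (¬ᶠ φ)))

module _ {V : Set} (K : Kripke V) where

  -- A biconditional true at a state gives each implication up to double
  -- negation (⇔ is encoded through ∧ᶠ, i.e. through a negated implication).
  ⇔-forward : ∀ j (φ ψ : Formula V) →
              K , j ⊨ (φ ⇔ ψ) → K , j ⊨ φ → ¬ ¬ (K , j ⊨ ψ)
  ⇔-forward _ _ _ φ⇔ψ φ-holds ¬ψ = φ⇔ψ (λ φ⇒ψ _ → ¬ψ (φ⇒ψ φ-holds))

  ⇔-backward : ∀ j (φ ψ : Formula V) →
               K , j ⊨ (φ ⇔ ψ) → K , j ⊨ ψ → ¬ ¬ (K , j ⊨ φ)
  ⇔-backward _ _ _ φ⇔ψ ψ-holds ¬φ = φ⇔ψ (λ _ ψ⇒φ → ¬φ (ψ⇒φ ψ-holds))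

  □-suffix : ∀ {i j} (φ : Formula V) → i ≤ j → K , i ⊨ (□ φ) → K , j ⊨ (□ φ)
  □-suffix _ i≤j □φ k j≤k = □φ k (≤-trans i≤j j≤k)

  □⇒□◇ : ∀ {i} (φ : Formula V) → K , i ⊨ (□ φ) → K , i ⊨ (□ (◇ φ))
  □⇒□◇ _ □φ j i≤j □¬φ = □¬φ j ≤-refl (□φ j i≤j)

  never : ∀ {i} (φ : Formula V) →
          K , i ⊨ (□ (φ ⇔ ○□◇¬ φ)) → K , i ⊨ (□ (¬ᶠ φ))
  never φ fix j i≤j φ-at-j = ⇔-forward j φ (○□◇¬ φ) (fix j i≤j) φ-at-j refute
    where
    -- ψ at j makes ◇¬φ hold at j+1, but ¬¬φ holds at every m ≥ j+1.
    refute : ¬ (K , j ⊨ ○□◇¬ φ)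
    refute ψ-at-j = ψ-at-j (suc j) ≤-refl ¬¬φ-from-j+1
      where
      ¬¬φ-from-j+1 : K , suc j ⊨ (□ (¬ᶠ (¬ᶠ φ)))
      ¬¬φ-from-j+1 m j<m =
        ⇔-backward m φ (○□◇¬ φ) (fix m (≤-trans i≤j (≤-trans (n≤1+n j) j<m)))
                   (□-suffix (◇ (¬ᶠ φ)) (m≤n⇒m≤1+n j<m) ψ-at-j)

theorem4p3 : {V : Set} (φ : Formula V) → LTL⊨ (¬ᶠ (□ (φ ⇔ ○ (□ (◇ (¬ᶠ φ))))))
theorem4p3 φ K i fix = ⇔-backward K i φ (○□◇¬ φ) (fix i ≤-refl) ψ-at-i (¬φ i ≤-refl)
  where
  ¬φ : K , i ⊨ (□ (¬ᶠ φ))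
  ¬φ = never K φ fix

  ψ-at-i : K , i ⊨ ○□◇¬ φ
  ψ-at-i = □⇒□◇ K (¬ᶠ φ) (□-suffix K (¬ᶠ φ) (n≤1+n i) ¬φ)
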